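{- Let $(P,\leq)$ be a poset and $f \in \operatorname{Aut}(P)$. Then $<_f^s$ is a strict partial order and $\leq_f^w$ is a (non-strict) partial order on the orbital quotient $P/{\sim_f}$.
   Context: For $f\in\operatorname{Aut}(P)$: $x\sim_f y$ iff $f^i(x)\le y\le f^j(x)$ for some $i,j\in\mathbb{Z}$ (an equivalence relation), with class $\mathcal{O}_f(x)$; $P/{\sim_f}$ is the set of classes. $\mathcal{O}_f(x) <_f^s \mathcal{O}_f(y)$ iff $x'<y'$ for all $x'\sim_f x$, $y'\sim_f y$; $\mathcal{O}_f(x) \leq_f^w \mathcal{O}_f(y)$ iff $x'\le y'$ for some $x'\sim_f x$, $y'\sim_f y$. -}

module Defs where

open import Level using (Level; _⊔_)
open import Data.Nat using (ℕ; zero; suc)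
open import Data.Integer using (ℤ; +_; -[1+_])
open import Data.Product using (_×_; ∃₂)
open import Relation.Binary.Bundles using (Poset)
import Relation.Binary.Construct.NonStrictToStrict as NSS

module _ {c ℓ₁ ℓ₂ : Level} (P : Poset c ℓ₁ ℓ₂) where
  open Poset P

  record Aut : Set (c ⊔ ℓ₁ ⊔ ℓ₂) where
    field
      to       : Carrier → Carrier
      from     : Carrier → Carrier
      to-mono  : ∀ {x y} → x ≤ y → to x ≤ to y
      from-mono : ∀ {x y} → x ≤ y → from x ≤ from y
      to-from  : ∀ x → to (from x) ≈ x
      from-to  : ∀ x → from (to x) ≈ x

  iterate : ℕ → (Carrier → Carrier) → Carrier → Carrier
  iterate zero    g x = x
  iterate (suc n) g x = g (iterate n g x)

  pow : Aut → ℤ → Carrier → Carrier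
  pow f (+ n)      = iterate n (Aut.to f)
  pow f -[1+ n ]   = iterate (suc n) (Aut.from f)

  _<P_ : Carrier → Carrier → Set (ℓ₁ ⊔ ℓ₂)
  _<P_ = NSS._<_ _≈_ _≤_

  _∼[_]_ : Carrier → Aut → Carrier → Set ℓ₂
  x ∼[ f ] y = ∃₂ λ (i j : ℤ) → (pow f i x ≤ y) × (y ≤ pow f j x)

  -- O_f(x) <_f^s O_f(y), expressed on representatives
  strictOrb : Aut → Carrier → Carrier → Set (c ⊔ ℓ₁ ⊔ ℓ₂)
  strictOrb f x y = ∀ x' y' → x' ∼[ f ] x → y' ∼[ f ] y → x' <P y'

  -- O_f(x) ≤_f^w O_f(y), expressed on representatives
  weakOrb : Aut → Carrier → Carrier → Set (c ⊔ ℓ₂)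
  weakOrb f x y = ∃₂ λ x' y' → (x' ∼[ f ] x) × (y' ∼[ f ] y) × (x' ≤ y')

-- The powers of f form a group of automorphisms (f^k ∘ f^i ≈ f^(k+i), f^(-i) ∘ f^i ≈ id),
-- which makes ∼_f an equivalence whose classes are convex. The strict relation then
-- inherits irreflexivity and transitivity directly from < on P. For the weak relation,
-- a comparison y'' ≤ z' can be moved along the class of y'': if y' ∼ y'' then
-- y' ≤ f^j(y'') ≤ f^j(z') for a suitable j, and f^j(z') lies in the class of z'. This
-- gives transitivity, and for antisymmetry it traps y' between x' and a member of the
-- class of x', so the two classes meet by convexity.
module Submission where

open import Level using (Level; _⊔_)
open import Data.Nat using (ℕ; zero; suc)
open import Data.Integer using (ℤ; +_; -[1+_]; _+_; -_; 1ℤ; -1ℤ)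
open import Data.Integer.Properties using (+-identityˡ; +-assoc; +-inverseˡ)
open import Data.Product using (Σ-syntax; _×_; _,_)
open import Relation.Binary.Bundles using (Poset)
open import Relation.Binary.Structures
  using (IsEquivalence; IsStrictPartialOrder; IsPartialOrder)
open import Relation.Binary.PropositionalEquality using (_≡_; cong; sym)
import Relation.Binary.Construct.NonStrictToStrict as NonStrictToStrict
import Relation.Binary.Reasoning.Setoid as SetoidReasoning
import Relation.Binary.Reasoning.PartialOrder as PosetReasoning

open import Defs

module _ {c ℓ₁ ℓ₂ : Level} (P : Poset c ℓ₁ ℓ₂) where
  open Poset P

  Monotone : (Carrier → Carrier) → Set (c ⊔ ℓ₂)
  Monotone g = ∀ {x y} → x ≤ y → g x ≤ g y

  monotone⇒cong : ∀ {g} → Monotone g → ∀ {x y} → x ≈ y → g x ≈ g y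
  monotone⇒cong mono x≈y = antisym (mono (reflexive x≈y)) (mono (reflexive (Eq.sym x≈y)))

  iterate-mono : ∀ {g} → Monotone g → ∀ n → Monotone (iterate P n g)
  iterate-mono mono zero    x≤y = x≤y
  iterate-mono mono (suc n) x≤y = mono (iterate-mono mono n x≤y)

module OrbitalOrders {c ℓ₁ ℓ₂ : Level} (P : Poset c ℓ₁ ℓ₂) (f : Aut P) where
  open Poset P hiding (_∼_)
  open Aut f
  open NonStrictToStrict _≈_ _≤_ using (<-irrefl; <-trans)

  f^ : ℤ → Carrier → Carrier
  f^ = pow P f

  _∼_ : Carrier → Carrier → Set ℓ₂
  x ∼ y = _∼[_]_ P x f y

  to-cong : ∀ {x y} → x ≈ y → to x ≈ to y
  to-cong = monotone⇒cong P to-mono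

  from-cong : ∀ {x y} → x ≈ y → from x ≈ from y
  from-cong = monotone⇒cong P from-mono

  f^-mono : ∀ i → Monotone P (f^ i)
  f^-mono (+ n)    = iterate-mono P to-mono n
  f^-mono -[1+ n ] = iterate-mono P from-mono (suc n)

  f^-index : ∀ {i j} → i ≡ j → ∀ x → f^ i x ≈ f^ j x
  f^-index i≡j x = Eq.reflexive (cong (λ k → f^ k x) i≡j)

  to-f^ : ∀ i x → to (f^ i x) ≈ f^ (1ℤ + i) x
  to-f^ (+ n)        x = Eq.refl
  to-f^ -[1+ zero ]  x = to-from x
  to-f^ -[1+ suc n ] x = to-from (f^ -[1+ n ] x)

  from-f^ : ∀ i x → from (f^ i x) ≈ f^ (-1ℤ + i) x
  from-f^ (+ zero)  x = Eq.refl
  from-f^ (+ suc n) x = from-to (f^ (+ n) x)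
  from-f^ -[1+ n ]  x = Eq.refl

  f^-+ : ∀ k i x → f^ k (f^ i x) ≈ f^ (k + i) x
  f^-+ (+ zero) i x = f^-index (sym (+-identityˡ i)) x
  f^-+ (+ suc n) i x = begin
    to (f^ (+ n) (f^ i x))  ≈⟨ to-cong (f^-+ (+ n) i x) ⟩
    to (f^ (+ n + i) x)     ≈⟨ to-f^ (+ n + i) x ⟩
    f^ (1ℤ + (+ n + i)) x   ≈⟨ f^-index (sym (+-assoc 1ℤ (+ n) i)) x ⟩
    f^ (+ suc n + i) x      ∎
    where open SetoidReasoning Eq.setoid
  f^-+ -[1+ zero ] i x = from-f^ i x
  f^-+ -[1+ suc n ] i x = begin
    from (f^ -[1+ n ] (f^ i x))  ≈⟨ from-cong (f^-+ -[1+ n ] i x) ⟩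
    from (f^ (-[1+ n ] + i) x)   ≈⟨ from-f^ (-[1+ n ] + i) x ⟩
    f^ (-1ℤ + (-[1+ n ] + i)) x  ≈⟨ f^-index (sym (+-assoc -1ℤ -[1+ n ] i)) x ⟩
    f^ (-[1+ suc n ] + i) x      ∎
    where open SetoidReasoning Eq.setoid

  f^-inverseˡ : ∀ i x → f^ (- i) (f^ i x) ≈ x
  f^-inverseˡ i x = Eq.trans (f^-+ (- i) i x) (f^-index (+-inverseˡ i) x)

  ∼-refl : ∀ {x} → x ∼ x
  ∼-refl = + 0 , + 0 , refl , refl

  ∼-sym : ∀ {x y} → x ∼ y → y ∼ x
  ∼-sym {x} {y} (i , j , fⁱx≤y , y≤fʲx) = - j , - i , lower , upper
    where
    open PosetReasoning P
    lower : f^ (- j) y ≤ x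
    lower = begin
      f^ (- j) y          ≤⟨ f^-mono (- j) y≤fʲx ⟩
      f^ (- j) (f^ j x)   ≈⟨ f^-inverseˡ j x ⟩
      x                   ∎
    upper : x ≤ f^ (- i) y
    upper = begin
      x                   ≈⟨ f^-inverseˡ i x ⟨
      f^ (- i) (f^ i x)   ≤⟨ f^-mono (- i) fⁱx≤y ⟩
      f^ (- i) y          ∎

  ∼-trans : ∀ {x y z} → x ∼ y → y ∼ z → x ∼ z
  ∼-trans {x} {y} {z} (i , j , fⁱx≤y , y≤fʲx) (k , l , fᵏy≤z , z≤fˡy) =
    k + i , l + j , lower , upper
    where
    open PosetReasoning P
    lower : f^ (k + i) x ≤ z
    lower = begin
      f^ (k + i) x        ≈⟨ f^-+ k i x ⟨
      f^ k (f^ i x)       ≤⟨ f^-mono k fⁱx≤y ⟩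
      f^ k y              ≤⟨ fᵏy≤z ⟩
      z                   ∎
    upper : z ≤ f^ (l + j) x
    upper = begin
      z                   ≤⟨ z≤fˡy ⟩
      f^ l y              ≤⟨ f^-mono l y≤fʲx ⟩
      f^ l (f^ j x)       ≈⟨ f^-+ l j x ⟩
      f^ (l + j) x        ∎

  ∼-isEquivalence : IsEquivalence _∼_
  ∼-isEquivalence = record { refl = ∼-refl ; sym = ∼-sym ; trans = ∼-trans }

  f^-∼ : ∀ i x → f^ i x ∼ x
  f^-∼ i x = ∼-sym (i , i , refl , refl)

  ∼-convex : ∀ {x y z} → x ≤ y → y ≤ z → x ∼ z → x ∼ y
  ∼-convex x≤y y≤z (_ , j , _ , z≤fʲx) = + 0 , j , x≤y , trans y≤z z≤fʲx

  ∼-≤-lift : ∀ {y y' z} → y ∼ y' → y ≤ z → Σ[ z' ∈ Carrier ] (z' ∼ z × y' ≤ z')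
  ∼-≤-lift {z = z} (_ , j , _ , y'≤fʲy) y≤z =
    f^ j z , f^-∼ j z , trans y'≤fʲy (f^-mono j y≤z)

  strictOrb-isStrictPartialOrder : IsStrictPartialOrder _∼_ (strictOrb P f)
  strictOrb-isStrictPartialOrder = record
    { isEquivalence = ∼-isEquivalence
    ; irrefl        = λ {x} x∼y x<y → <-irrefl Eq.refl (x<y x x ∼-refl x∼y)
    ; trans         = λ {_} {y} x<y y<z x' z' x'∼x z'∼z →
                        <-trans isPartialOrder (x<y x' y x'∼x ∼-refl) (y<z y z' ∼-refl z'∼z)
    ; <-resp-≈      = (λ y∼y' x<y x' y'' x'∼x y''∼y' → x<y x' y'' x'∼x (∼-trans y''∼y' (∼-sym y∼y')))
                    , (λ y∼y' y<x y'' x' y''∼y' x'∼x → y<x y'' x' (∼-trans y''∼y' (∼-sym y∼y')) x'∼x)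
    }

  weakOrb-reflexive : ∀ {x y} → x ∼ y → weakOrb P f x y
  weakOrb-reflexive {y = y} x∼y = y , y , ∼-sym x∼y , ∼-refl , refl

  weakOrb-trans : ∀ {x y z} → weakOrb P f x y → weakOrb P f y z → weakOrb P f x z
  weakOrb-trans (x' , y' , x'∼x , y'∼y , x'≤y') (y'' , z' , y''∼y , z'∼z , y''≤z')
    with ∼-≤-lift (∼-trans y''∼y (∼-sym y'∼y)) y''≤z'
  ... | z'' , z''∼z' , y'≤z'' = x' , z'' , x'∼x , ∼-trans z''∼z' z'∼z , trans x'≤y' y'≤z''

  weakOrb-antisym : ∀ {x y} → weakOrb P f x y → weakOrb P f y x → x ∼ y
  weakOrb-antisym (x' , y' , x'∼x , y'∼y , x'≤y') (y'' , x'' , y''∼y , x''∼x , y''≤x'')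
    with ∼-≤-lift (∼-trans y''∼y (∼-sym y'∼y)) y''≤x''
  ... | w , w∼x'' , y'≤w =
    ∼-trans (∼-sym x'∼x) (∼-trans x'∼y' y'∼y)
    where
    x'∼y' : x' ∼ y'
    x'∼y' = ∼-convex x'≤y' y'≤w (∼-sym (∼-trans w∼x'' (∼-trans x''∼x (∼-sym x'∼x))))

  weakOrb-isPartialOrder : IsPartialOrder _∼_ (weakOrb P f)
  weakOrb-isPartialOrder = record
    { isPreorder = record
      { isEquivalence = ∼-isEquivalence
      ; reflexive     = weakOrb-reflexive
      ; trans         = weakOrb-trans
      }
    ; antisym = weakOrb-antisym
    }

mainTheorem14 : {c ℓ₁ ℓ₂ : Level} (P : Poset c ℓ₁ ℓ₂) (f : Aut P) →
    IsStrictPartialOrder (λ x y → _∼[_]_ P x f y) (strictOrb P f)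
      × IsPartialOrder (λ x y → _∼[_]_ P x f y) (weakOrb P f)
mainTheorem14 P f = strictOrb-isStrictPartialOrder , weakOrb-isPartialOrder
  where open OrbitalOrders P f
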